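{- There is no set $\tau(x)$ of equations in one variable $x$ such that, for all sets of formulas $\Gamma\cup\{\phi\}$, $\Gamma\vdash_w\phi$ iff $\tau(\Gamma)\models_{\mathcal{BHA}}\tau(\phi)$. That is, wBIL has no $\tau$-algebraic semantics with respect to $\mathcal{BHA}$.
   Context: Fix a countably infinite set $\mathrm{Prop}$ of propositional variables. Bi-intuitionistic formulas are generated by $\phi ::= p \mid \bot \mid \top \mid \phi\wedge\phi \mid \phi\vee\phi \mid \phi\to\phi \mid \phi\prec\phi$ with $p\in\mathrm{Prop}$ ($\prec$ is exclusion). Abbreviations: $\neg\phi := \phi\to\bot$, ${\sim}\phi := \top\prec\phi$. An axiom is any instance of: (A1) $\phi\to(\psi\to\phi)$; (A2) $(\phi\to(\psi\to\chi))\to((\phi\to\psi)\to(\phi\to\chi))$; (A3) $\phi\to(\phi\vee\psi)$; (A4) $\psi\to(\phi\vee\psi)$; (A5) $(\phi\to\chi)\to((\psi\to\chi)\to((\phi\vee\psi)\to\chi))$; (A6) $(\phi\wedge\psi)\to\phi$; (A7) $(\phi\wedge\psi)\to\psi$; (A8) $(\chi\to\phi)\to((\chi\to\psi)\to(\chi\to(\phi\wedge\psi)))$; (A9) $\bot\to\phi$; (A10) $\phi\to\top$; (A11) $\phi\to(\psi\vee(\phi\prec\psi))$; (A12) $(\phi\prec\psi)\to{\sim}(\phi\to\psi)$; (A13) $((\phi\prec\psi)\prec\chi)\to(\phi\prec(\psi\vee\chi))$; (A14) $\neg(\phi\prec\psi)\to(\phi\to\psi)$. wBIL is the relation $\Gamma\vdash_w\phi$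 holding iff $\Gamma\vdash\phi$ is derivable with: (Ax) $\Gamma\vdash\phi$ for any axiom $\phi$; (El) $\Gamma\vdash\phi$ if $\phi\in\Gamma$; (MP) from $\Gamma\vdash\phi$ and $\Gamma\vdash\phi\to\psi$ infer $\Gamma\vdash\psi$; (wDN) from $\emptyset\vdash\phi$ infer $\Gamma\vdash\neg{\sim}\phi$. A bi-Heyting algebra is an algebra $(A,\top,\bot,\wedge,\vee,\to,\prec)$ whose reduct $(A,\top,\bot,\wedge,\vee)$ is a bounded lattice (order $a\le b$ iff $a=a\wedge b$) with $a\wedge b\le c\iff a\le b\to c$ and $a\le b\vee c\iff a\prec b\le c$ for all $a,b,c$; $\mathcal{BHA}$ is the class of all bi-Heyting algebras. Valuations $v:\mathrm{Prop}\to A$ extend to $\bar v$ on formulas. An equation is a pair of formulas $\phi=\psi$; $\Theta\models_{\mathcal{BHA}}\Xi$ (for sets of equations) means: for every $A\in\mathcal{BHA}$ and valuation $v$, if $\bar v(\theta)=\bar v(\eta)$ for all $(\theta=\eta)\in\Theta$ then the same holds for all equations in $\Xi$. $\tau(\phi)$ is $\tau(x)$ with $x$ replaced by $\phi$, and $\tau(\Gamma)=\bigcup_{\gamma\in\Gamma}\tau(\gamma)$. -}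

module Defs where

open import Data.Nat using (ℕ)
open import Data.Unit using (⊤; tt)
open import Data.Product using (_×_; _,_; Σ; ∃; ∃-syntax)
open import Data.Empty using () renaming (⊥ to Empty)
open import Relation.Binary.PropositionalEquality using (_≡_)
open import Relation.Unary using (Pred; _∈_)
open import Function using (_⇔_)
open import Level using (0ℓ)

infixr 6 _∧'_
infixr 5 _∨'_
infixr 4 _⇒_ _≺_

data Fm (V : Set) : Set where
  var  : V → Fm V
  ⊥'   : Fm V
  ⊤'   : Fm V
  _∧'_ : Fm V → Fm V → Fm V
  _∨'_ : Fm V → Fm V → Fm V
  _⇒_  : Fm V → Fm V → Fm V
  _≺_  : Fm V → Fm V → Fm V

Formula : Set
Formula = Fm ℕ

¬' : Formula → Formula
¬' φ = φ ⇒ ⊥'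

∼' : Formula → Formula
∼' φ = ⊤' ≺ φ

data Axiom : Formula → Set where
  A1  : ∀ φ ψ → Axiom (φ ⇒ (ψ ⇒ φ))
  A2  : ∀ φ ψ χ → Axiom ((φ ⇒ (ψ ⇒ χ)) ⇒ ((φ ⇒ ψ) ⇒ (φ ⇒ χ)))
  A3  : ∀ φ ψ → Axiom (φ ⇒ (φ ∨' ψ))
  A4  : ∀ φ ψ → Axiom (ψ ⇒ (φ ∨' ψ))
  A5  : ∀ φ ψ χ → Axiom ((φ ⇒ χ) ⇒ ((ψ ⇒ χ) ⇒ ((φ ∨' ψ) ⇒ χ)))
  A6  : ∀ φ ψ → Axiom ((φ ∧' ψ) ⇒ φ)
  A7  : ∀ φ ψ → Axiom ((φ ∧' ψ) ⇒ ψ)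
  A8  : ∀ φ ψ χ → Axiom ((χ ⇒ φ) ⇒ ((χ ⇒ ψ) ⇒ (χ ⇒ (φ ∧' ψ))))
  A9  : ∀ φ → Axiom (⊥' ⇒ φ)
  A10 : ∀ φ → Axiom (φ ⇒ ⊤')
  A11 : ∀ φ ψ → Axiom (φ ⇒ (ψ ∨' (φ ≺ ψ)))
  A12 : ∀ φ ψ → Axiom ((φ ≺ ψ) ⇒ ∼' (φ ⇒ ψ))
  A13 : ∀ φ ψ χ → Axiom (((φ ≺ ψ) ≺ χ) ⇒ (φ ≺ (ψ ∨' χ)))
  A14 : ∀ φ ψ → Axiom (¬' (φ ≺ ψ) ⇒ (φ ⇒ ψ))

∅ : Pred Formula 0ℓ
∅ _ = Empty

data _⊢w_ (Γ : Pred Formula 0ℓ) : Formula → Set where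
  ax  : ∀ {φ} → Axiom φ → Γ ⊢w φ
  el  : ∀ {φ} → φ ∈ Γ → Γ ⊢w φ
  mp  : ∀ {φ ψ} → Γ ⊢w φ → Γ ⊢w (φ ⇒ ψ) → Γ ⊢w ψ
  wdn : ∀ {φ} → ∅ ⊢w φ → Γ ⊢w ¬' (∼' φ)

record BHA : Set₁ where
  field
    Carrier : Set
    top bot : Carrier
    _⊓_ _⊔_ _⇨_ _⊸_ : Carrier → Carrier → Carrier
    ⊓-assoc : ∀ a b c → (a ⊓ b) ⊓ c ≡ a ⊓ (b ⊓ c)
    ⊔-assoc : ∀ a b c → (a ⊔ b) ⊔ c ≡ a ⊔ (b ⊔ c)
    ⊓-comm  : ∀ a b → a ⊓ b ≡ b ⊓ a
    ⊔-comm  : ∀ a b → a ⊔ b ≡ b ⊔ a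
    ⊓-absorb : ∀ a b → a ⊓ (a ⊔ b) ≡ a
    ⊔-absorb : ∀ a b → a ⊔ (a ⊓ b) ≡ a
    ⊓-top : ∀ a → a ⊓ top ≡ a
    ⊔-bot : ∀ a → a ⊔ bot ≡ a

  _≤_ : Carrier → Carrier → Set
  a ≤ b = a ≡ a ⊓ b

  field
    ⇨-residual : ∀ a b c → ((a ⊓ b) ≤ c) ⇔ (a ≤ (b ⇨ c))
    ⊸-residual : ∀ a b c → (a ≤ (b ⊔ c)) ⇔ ((a ⊸ b) ≤ c)

open BHA public using (Carrier)

⟦_⟧ : ∀ {V} (A : BHA) → Fm V → (V → Carrier A) → Carrier A
⟦ A ⟧ (var p) v = v p
⟦ A ⟧ ⊥' v = BHA.bot A
⟦ A ⟧ ⊤' v = BHA.top A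
⟦ A ⟧ (φ ∧' ψ) v = BHA._⊓_ A (⟦ A ⟧ φ v) (⟦ A ⟧ ψ v)
⟦ A ⟧ (φ ∨' ψ) v = BHA._⊔_ A (⟦ A ⟧ φ v) (⟦ A ⟧ ψ v)
⟦ A ⟧ (φ ⇒ ψ) v = BHA._⇨_ A (⟦ A ⟧ φ v) (⟦ A ⟧ ψ v)
⟦ A ⟧ (φ ≺ ψ) v = BHA._⊸_ A (⟦ A ⟧ φ v) (⟦ A ⟧ ψ v)

Equation : Set → Set
Equation V = Fm V × Fm V

_⊨BHA_ : Pred (Equation ℕ) 0ℓ → Pred (Equation ℕ) 0ℓ → Set₁
Θ ⊨BHA Ξ = (A : BHA) (v : ℕ → Carrier A) →
  (∀ {θ η} → (θ , η) ∈ Θ → ⟦ A ⟧ θ v ≡ ⟦ A ⟧ η v) →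
  (∀ {θ η} → (θ , η) ∈ Ξ → ⟦ A ⟧ θ v ≡ ⟦ A ⟧ η v)

-- formulas in the single variable x (x = var tt)
Fm₁ : Set
Fm₁ = Fm ⊤

_[_] : Fm₁ → Formula → Formula
var tt [ φ ] = φ
⊥' [ φ ] = ⊥'
⊤' [ φ ] = ⊤'
(α ∧' β) [ φ ] = (α [ φ ]) ∧' (β [ φ ])
(α ∨' β) [ φ ] = (α [ φ ]) ∨' (β [ φ ])
(α ⇒ β) [ φ ] = (α [ φ ]) ⇒ (β [ φ ])
(α ≺ β) [ φ ] = (α [ φ ]) ≺ (β [ φ ])

τ⟨_⟩ : Pred (Equation ⊤) 0ℓ → Formula → Pred (Equation ℕ) 0ℓ
τ⟨ τ ⟩ φ (θ , η) = ∃[ ε ] ∃[ δ ] ((ε , δ) ∈ τ × θ ≡ ε [ φ ] × η ≡ δ [ φ ])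

τ⟦_⟧ : Pred (Equation ⊤) 0ℓ → Pred Formula 0ℓ → Pred (Equation ℕ) 0ℓ
τ⟦ τ ⟧ Γ e = ∃[ γ ] (γ ∈ Γ × e ∈ τ⟨ τ ⟩ γ)

-- Suppose τ were such a translation.  Since ⊢ ⊤, every equation ε = δ of τ holds at top in
-- every bi-Heyting algebra, so p ⊢ ¬∼(ε[p] ↔ δ[p]).  In the five-element algebra (the
-- Boolean algebra 2² with a new top) the principal filters ↑A and ↑B are closed under the
-- rules of wBIL, and ¬∼c lies in them only if c is the top; hence τ holds at A and at B.
-- As p, q ⊢ p ∧ q, it then holds at A ∧ B = bottom.  But at the bottom every one-variable
-- term takes the Boolean value given by its truth table, so τ holds at the bottom of every
-- bi-Heyting algebra, whence ⊢ ⊥, contradicting soundness for the five-element algebra.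
module Submission where

open import Defs
open import Data.Nat using (ℕ)
open import Data.Unit using (⊤)
open import Data.Product using (Σ)
open import Relation.Nullary using (¬_)
open import Relation.Unary using (Pred)
open import Function using (_⇔_)
open import Level using (0ℓ)

open import Data.Bool using (Bool; true; false; _∧_; _∨_; not)
open import Data.Empty using (⊥-elim)
open import Data.Fin using (Fin; zero; suc; _≟_)
open import Data.Fin.Properties using (all?)
open import Data.Product using (_,_)
open import Data.Sum using (_⊎_; inj₁; inj₂; [_,_]′)
open import Function using (mk⇔; Equivalence)
open import Relation.Binary.PropositionalEquality
  using (_≡_; _≢_; refl; sym; trans; cong; cong₂; subst; module ≡-Reasoning)
open import Relation.Nullary.Decidable
  using (Dec; True; from-yes; toWitness; map′; _×-dec_; _→-dec_; _⊎-dec_)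
open import Relation.Unary using (_∈_; ｛_｝; _∪_)

open Equivalence using (to; from)

module BHA-Properties (𝔸 : BHA) where
  open BHA 𝔸
  open ≡-Reasoning

  ⊓-idem : ∀ a → a ⊓ a ≡ a
  ⊓-idem a = trans (cong (a ⊓_) (sym (⊔-absorb a a))) (⊓-absorb a (a ⊓ a))

  top-⊓ : ∀ a → top ⊓ a ≡ a
  top-⊓ a = trans (⊓-comm top a) (⊓-top a)

  bot-⊓ : ∀ a → bot ⊓ a ≡ bot
  bot-⊓ a = trans (cong (bot ⊓_) (sym (trans (⊔-comm bot a) (⊔-bot a)))) (⊓-absorb bot a)

  ⊓-bot : ∀ a → a ⊓ bot ≡ bot
  ⊓-bot a = trans (⊓-comm a bot) (bot-⊓ a)

  bot-⊔ : ∀ a → bot ⊔ a ≡ a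
  bot-⊔ a = trans (⊔-comm bot a) (⊔-bot a)

  top-⊔ : ∀ a → top ⊔ a ≡ top
  top-⊔ a = trans (cong (top ⊔_) (sym (top-⊓ a))) (⊔-absorb top a)

  ≤-refl : ∀ a → a ≤ a
  ≤-refl a = sym (⊓-idem a)

  ≤-antisym : ∀ {a b} → a ≤ b → b ≤ a → a ≡ b
  ≤-antisym {a} {b} a≤b b≤a = trans a≤b (trans (⊓-comm a b) (sym b≤a))

  ⊓-≤ˡ : ∀ a b → (a ⊓ b) ≤ a
  ⊓-≤ˡ a b = begin
    a ⊓ b        ≡⟨ cong (_⊓ b) (≤-refl a) ⟩
    (a ⊓ a) ⊓ b  ≡⟨ ⊓-assoc a a b ⟩
    a ⊓ (a ⊓ b)  ≡⟨ ⊓-comm a (a ⊓ b) ⟩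
    (a ⊓ b) ⊓ a  ∎

  ⊓-≤ʳ : ∀ a b → (a ⊓ b) ≤ b
  ⊓-≤ʳ a b = trans (cong (a ⊓_) (≤-refl b)) (sym (⊓-assoc a b b))

  ≤-top : ∀ a → a ≤ top
  ≤-top a = sym (⊓-top a)

  bot-≤ : ∀ a → bot ≤ a
  bot-≤ a = sym (bot-⊓ a)

  top-maximal : ∀ {a} → top ≤ a → a ≡ top
  top-maximal {a} top≤a = ≤-antisym (≤-top a) top≤a

  bot-minimal : ∀ {a} → a ≤ bot → a ≡ bot
  bot-minimal {a} a≤bot = trans a≤bot (⊓-bot a)

  ⇨-intro : ∀ {a b c} → (a ⊓ b) ≤ c → a ≤ (b ⇨ c)
  ⇨-intro {a} {b} {c} = to (⇨-residual a b c)

  ⇨-elim : ∀ {a b c} → a ≤ (b ⇨ c) → (a ⊓ b) ≤ c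
  ⇨-elim {a} {b} {c} = from (⇨-residual a b c)

  modus-ponens-≤ : ∀ {a b c} → a ≤ b → a ≤ (b ⇨ c) → a ≤ c
  modus-ponens-≤ {a} {b} {c} a≤b a≤b⇨c = begin
    a            ≡⟨ a≤b ⟩
    a ⊓ b        ≡⟨ ⇨-elim a≤b⇨c ⟩
    (a ⊓ b) ⊓ c  ≡⟨ cong (_⊓ c) (sym a≤b) ⟩
    a ⊓ c        ∎

  ⇨-self : ∀ a → a ⇨ a ≡ top
  ⇨-self a = top-maximal (⇨-intro (⊓-≤ʳ top a))

  ⇨-top⇒≤ : ∀ {a b} → a ⇨ b ≡ top → a ≤ b
  ⇨-top⇒≤ {a} {b} eq =
    subst (_≤ b) (top-⊓ a) (⇨-elim (subst (top ≤_) (sym eq) (≤-refl top)))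

  ⊓-top⇒ˡ : ∀ {a b} → a ⊓ b ≡ top → a ≡ top
  ⊓-top⇒ˡ {a} {b} eq = top-maximal (subst (_≤ a) eq (⊓-≤ˡ a b))

  ⊓-top⇒ʳ : ∀ {a b} → a ⊓ b ≡ top → b ≡ top
  ⊓-top⇒ʳ {a} {b} eq = top-maximal (subst (_≤ b) eq (⊓-≤ʳ a b))

  ⇔-top⇒≡ : ∀ {a b} → (a ⇨ b) ⊓ (b ⇨ a) ≡ top → a ≡ b
  ⇔-top⇒≡ eq = ≤-antisym (⇨-top⇒≤ (⊓-top⇒ˡ eq)) (⇨-top⇒≤ (⊓-top⇒ʳ eq))

  ⊸-self : ∀ a → a ⊸ a ≡ bot
  ⊸-self a = bot-minimal (to (⊸-residual a a bot) (sym (⊓-absorb a bot)))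

  ¬∼-top : ∀ {a} → a ≡ top → ((top ⊸ a) ⇨ bot) ≡ top
  ¬∼-top refl = trans (cong (_⇨ bot) (⊸-self top)) (⇨-self bot)

  ≡⇒⇔-top : ∀ {a b} → a ≡ b → ((a ⇨ b) ⊓ (b ⇨ a)) ≡ top
  ≡⇒⇔-top {a} refl = trans (⊓-idem (a ⇨ a)) (⇨-self a)

  top-⇨ : ∀ a → top ⇨ a ≡ a
  top-⇨ a = ≤-antisym (subst (_≤ a) (⊓-top (top ⇨ a)) (⇨-elim (≤-refl (top ⇨ a))))
                      (⇨-intro (⊓-≤ˡ a top))

  bot-⇨ : ∀ a → bot ⇨ a ≡ top
  bot-⇨ a = top-maximal (⇨-intro (subst (_≤ a) (sym (⊓-bot top)) (bot-≤ a)))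

  top-⊸-bot : top ⊸ bot ≡ top
  top-⊸-bot = top-maximal
    (subst (top ≤_) (bot-⊔ (top ⊸ bot)) (from (⊸-residual top bot _) (≤-refl _)))

  bot-⊸ : ∀ a → bot ⊸ a ≡ bot
  bot-⊸ a = bot-minimal (to (⊸-residual bot a bot) (bot-≤ _))

  fromBool : Bool → Carrier 𝔸
  fromBool true  = top
  fromBool false = bot

  fromBool-⊓ : ∀ x y → fromBool x ⊓ fromBool y ≡ fromBool (x ∧ y)
  fromBool-⊓ true  true  = ⊓-top top
  fromBool-⊓ true  false = ⊓-bot top
  fromBool-⊓ false y     = bot-⊓ (fromBool y)

  fromBool-⊔ : ∀ x y → fromBool x ⊔ fromBool y ≡ fromBool (x ∨ y)
  fromBool-⊔ true  y = top-⊔ (fromBool y)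
  fromBool-⊔ false y = bot-⊔ (fromBool y)

  fromBool-⇨ : ∀ x y → fromBool x ⇨ fromBool y ≡ fromBool (not x ∨ y)
  fromBool-⇨ true  y = top-⇨ (fromBool y)
  fromBool-⇨ false y = bot-⇨ (fromBool y)

  fromBool-⊸ : ∀ x y → fromBool x ⊸ fromBool y ≡ fromBool (x ∧ not y)
  fromBool-⊸ true  true  = ⊸-self top
  fromBool-⊸ true  false = top-⊸-bot
  fromBool-⊸ false y     = bot-⊸ (fromBool y)

  fromBool-injective : bot ≢ top → ∀ {x y} → fromBool x ≡ fromBool y → x ≡ y
  fromBool-injective _       {true}  {true}  _  = refl
  fromBool-injective _       {false} {false} _  = refl
  fromBool-injective bot≢top {true}  {false} eq = ⊥-elim (bot≢top (sym eq))
  fromBool-injective bot≢top {false} {true}  eq = ⊥-elim (bot≢top eq)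

⟦⟧-[] : (𝔸 : BHA) (α : Fm₁) (φ : Formula) (v : ℕ → Carrier 𝔸) →
        ⟦ 𝔸 ⟧ (α [ φ ]) v ≡ ⟦ 𝔸 ⟧ α (λ _ → ⟦ 𝔸 ⟧ φ v)
⟦⟧-[] 𝔸 (var _)  φ v = refl
⟦⟧-[] 𝔸 ⊥'       φ v = refl
⟦⟧-[] 𝔸 ⊤'       φ v = refl
⟦⟧-[] 𝔸 (α ∧' β) φ v = cong₂ (BHA._⊓_ 𝔸) (⟦⟧-[] 𝔸 α φ v) (⟦⟧-[] 𝔸 β φ v)
⟦⟧-[] 𝔸 (α ∨' β) φ v = cong₂ (BHA._⊔_ 𝔸) (⟦⟧-[] 𝔸 α φ v) (⟦⟧-[] 𝔸 β φ v)
⟦⟧-[] 𝔸 (α ⇒ β)  φ v = cong₂ (BHA._⇨_ 𝔸) (⟦⟧-[] 𝔸 α φ v) (⟦⟧-[] 𝔸 β φ v)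
⟦⟧-[] 𝔸 (α ≺ β)  φ v = cong₂ (BHA._⊸_ 𝔸) (⟦⟧-[] 𝔸 α φ v) (⟦⟧-[] 𝔸 β φ v)

truth : ∀ {V} → Fm V → (V → Bool) → Bool
truth (var x)  w = w x
truth ⊥'       w = false
truth ⊤'       w = true
truth (φ ∧' ψ) w = truth φ w ∧ truth ψ w
truth (φ ∨' ψ) w = truth φ w ∨ truth ψ w
truth (φ ⇒ ψ)  w = not (truth φ w) ∨ truth ψ w
truth (φ ≺ ψ)  w = truth φ w ∧ not (truth ψ w)

module _ (𝔸 : BHA) where
  open BHA-Properties 𝔸

  ⟦⟧-fromBool : ∀ {V} (φ : Fm V) (w : V → Bool) →
                ⟦ 𝔸 ⟧ φ (λ x → fromBool (w x)) ≡ fromBool (truth φ w)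
  ⟦⟧-fromBool (var x)  w = refl
  ⟦⟧-fromBool ⊥'       w = refl
  ⟦⟧-fromBool ⊤'       w = refl
  ⟦⟧-fromBool (φ ∧' ψ) w = trans (cong₂ (BHA._⊓_ 𝔸) (⟦⟧-fromBool φ w) (⟦⟧-fromBool ψ w))
                                 (fromBool-⊓ (truth φ w) (truth ψ w))
  ⟦⟧-fromBool (φ ∨' ψ) w = trans (cong₂ (BHA._⊔_ 𝔸) (⟦⟧-fromBool φ w) (⟦⟧-fromBool ψ w))
                                 (fromBool-⊔ (truth φ w) (truth ψ w))
  ⟦⟧-fromBool (φ ⇒ ψ)  w = trans (cong₂ (BHA._⇨_ 𝔸) (⟦⟧-fromBool φ w) (⟦⟧-fromBool ψ w))
                                 (fromBool-⇨ (truth φ w) (truth ψ w))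
  ⟦⟧-fromBool (φ ≺ ψ)  w = trans (cong₂ (BHA._⊸_ 𝔸) (⟦⟧-fromBool φ w) (⟦⟧-fromBool ψ w))
                                 (fromBool-⊸ (truth φ w) (truth ψ w))

Satisfies : (𝔸 : BHA) → (ℕ → Carrier 𝔸) → Pred (Equation ℕ) 0ℓ → Set
Satisfies 𝔸 v Θ = ∀ {θ η} → (θ , η) ∈ Θ → ⟦ 𝔸 ⟧ θ v ≡ ⟦ 𝔸 ⟧ η v

HoldsAt : Pred (Equation ⊤) 0ℓ → (𝔸 : BHA) → Carrier 𝔸 → Set
HoldsAt τ 𝔸 a = ∀ {ε δ} → (ε , δ) ∈ τ → ⟦ 𝔸 ⟧ ε (λ _ → a) ≡ ⟦ 𝔸 ⟧ δ (λ _ → a)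

module _ (τ : Pred (Equation ⊤) 0ℓ) {𝔸 : BHA} {v : ℕ → Carrier 𝔸} where

  satisfies-τ⟨⟩ : ∀ φ → HoldsAt τ 𝔸 (⟦ 𝔸 ⟧ φ v) → Satisfies 𝔸 v (τ⟨ τ ⟩ φ)
  satisfies-τ⟨⟩ φ holds (ε , δ , ε≈δ , refl , refl) =
    trans (⟦⟧-[] 𝔸 ε φ v) (trans (holds ε≈δ) (sym (⟦⟧-[] 𝔸 δ φ v)))

  holdsAt-τ⟨⟩ : ∀ φ → Satisfies 𝔸 v (τ⟨ τ ⟩ φ) → HoldsAt τ 𝔸 (⟦ 𝔸 ⟧ φ v)
  holdsAt-τ⟨⟩ φ sat {ε} {δ} ε≈δ =
    trans (sym (⟦⟧-[] 𝔸 ε φ v)) (trans (sat (ε , δ , ε≈δ , refl , refl)) (⟦⟧-[] 𝔸 δ φ v))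

  satisfies-τ⟦⟧ : ∀ {Γ} → (∀ {γ} → γ ∈ Γ → HoldsAt τ 𝔸 (⟦ 𝔸 ⟧ γ v)) → Satisfies 𝔸 v (τ⟦ τ ⟧ Γ)
  satisfies-τ⟦⟧ holds (γ , γ∈Γ , e) = satisfies-τ⟨⟩ γ (holds γ∈Γ) e

-- Soundness with respect to the principal filter ↑a; wDN is sound since its premise is
-- then valid and ¬∼top = top.
module Soundness (𝔸 : BHA) (axiom-valid : ∀ {φ} → Axiom φ → ∀ v → ⟦ 𝔸 ⟧ φ v ≡ BHA.top 𝔸) where
  open BHA 𝔸
  open BHA-Properties 𝔸

  ⊢w-sound : ∀ {Γ φ} → Γ ⊢w φ → ∀ a v → (∀ {γ} → γ ∈ Γ → a ≤ ⟦ 𝔸 ⟧ γ v) → a ≤ ⟦ 𝔸 ⟧ φ v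
  ⊢w-sound (ax α)    a v _     = subst (a ≤_) (sym (axiom-valid α v)) (≤-top a)
  ⊢w-sound (el γ∈Γ)  a v above = above γ∈Γ
  ⊢w-sound (mp d e)  a v above = modus-ponens-≤ (⊢w-sound d a v above) (⊢w-sound e a v above)
  ⊢w-sound (wdn d)   a v _     =
    subst (a ≤_) (sym (¬∼-top (top-maximal (⊢w-sound d top v λ ())))) (≤-top a)

_⇔?_ : ∀ {P Q : Set} → Dec P → Dec Q → Dec (P ⇔ Q)
P? ⇔? Q? = map′ (λ (f , g) → mk⇔ f g) (λ e → to e , from e) ((P? →-dec Q?) ×-dec (Q? →-dec P?))

-- O < A, B < AB < I.  As I is join-irreducible, ∼c = O if c = I and ∼c = I otherwise.
module Five where

  Five : Set
  Five = Fin 5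

  pattern O  = zero
  pattern A  = suc zero
  pattern B  = suc (suc zero)
  pattern AB = suc (suc (suc zero))
  pattern I  = suc (suc (suc (suc zero)))

  _⊓_ : Five → Five → Five
  O  ⊓ _  = O
  I  ⊓ b  = b
  AB ⊓ I  = AB
  AB ⊓ b  = b
  A  ⊓ O  = O
  A  ⊓ B  = O
  A  ⊓ _  = A
  B  ⊓ O  = O
  B  ⊓ A  = O
  B  ⊓ _  = B

  _⊔_ : Five → Five → Five
  I  ⊔ _  = I
  O  ⊔ b  = b
  _  ⊔ I  = I
  AB ⊔ _  = AB
  A  ⊔ O  = A
  A  ⊔ A  = A
  A  ⊔ _  = AB
  B  ⊔ O  = B
  B  ⊔ B  = B
  B  ⊔ _  = AB

  _⇨_ : Five → Five → Five
  O  ⇨ _  = I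
  I  ⇨ b  = b
  _  ⇨ I  = I
  _  ⇨ AB = I
  A  ⇨ A  = I
  A  ⇨ _  = B
  B  ⇨ B  = I
  B  ⇨ _  = A
  AB ⇨ b  = b

  _⊸_ : Five → Five → Five
  _  ⊸ I  = O
  I  ⊸ _  = I
  _  ⊸ AB = O
  O  ⊸ _  = O
  A  ⊸ A  = O
  A  ⊸ _  = A
  B  ⊸ B  = O
  B  ⊸ _  = B
  AB ⊸ O  = AB
  AB ⊸ A  = B
  AB ⊸ B  = A

  five : BHA
  five = record
    { Carrier = Five ; top = I ; bot = O
    ; _⊓_ = _⊓_ ; _⊔_ = _⊔_ ; _⇨_ = _⇨_ ; _⊸_ = _⊸_
    ; ⊓-assoc  = from-yes (all? λ a → all? λ b → all? λ c → (a ⊓ b) ⊓ c ≟ a ⊓ (b ⊓ c))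
    ; ⊔-assoc  = from-yes (all? λ a → all? λ b → all? λ c → (a ⊔ b) ⊔ c ≟ a ⊔ (b ⊔ c))
    ; ⊓-comm   = from-yes (all? λ a → all? λ b → a ⊓ b ≟ b ⊓ a)
    ; ⊔-comm   = from-yes (all? λ a → all? λ b → a ⊔ b ≟ b ⊔ a)
    ; ⊓-absorb = from-yes (all? λ a → all? λ b → a ⊓ (a ⊔ b) ≟ a)
    ; ⊔-absorb = from-yes (all? λ a → all? λ b → a ⊔ (a ⊓ b) ≟ a)
    ; ⊓-top    = from-yes (all? λ a → a ⊓ I ≟ a)
    ; ⊔-bot    = from-yes (all? λ a → a ⊔ O ≟ a)
    ; ⇨-residual = from-yes (all? λ a → all? λ b → all? λ c →
                     ((a ⊓ b) ≟ (a ⊓ b) ⊓ c) ⇔? (a ≟ a ⊓ (b ⇨ c)))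
    ; ⊸-residual = from-yes (all? λ a → all? λ b → all? λ c →
                     (a ≟ a ⊓ (b ⊔ c)) ⇔? ((a ⊸ b) ≟ (a ⊸ b) ⊓ c))
    }

  valuation₃ : Five → Five → Five → ℕ → Five
  valuation₃ a b c 0 = a
  valuation₃ a b c 1 = b
  valuation₃ a b c _ = c

  schema-valid : ∀ {θ} → Axiom θ →
    {True (all? λ a → all? λ b → all? λ c → ⟦ five ⟧ θ (valuation₃ a b c) ≟ I)} →
    ∀ a b c → ⟦ five ⟧ θ (valuation₃ a b c) ≡ I
  schema-valid _ {valid} = toWitness valid

  -- An instance of an axiom schema evaluates, definitionally, like the schema itself in the
  -- variables 0, 1, 2 under the valuation sending them to the values of its parameters.
  axiom-valid : ∀ {φ} → Axiom φ → ∀ v → ⟦ five ⟧ φ v ≡ I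
  axiom-valid α v = instance-of α
    where
    ⟦_⟧ᵛ : Formula → Five
    ⟦ φ ⟧ᵛ = ⟦ five ⟧ φ v

    x₀ x₁ x₂ : Formula
    x₀ = var 0
    x₁ = var 1
    x₂ = var 2

    instance-of : ∀ {φ} → Axiom φ → ⟦ φ ⟧ᵛ ≡ I
    instance-of (A1 φ ψ)    = schema-valid (A1 x₀ x₁)     ⟦ φ ⟧ᵛ ⟦ ψ ⟧ᵛ O
    instance-of (A2 φ ψ χ)  = schema-valid (A2 x₀ x₁ x₂)  ⟦ φ ⟧ᵛ ⟦ ψ ⟧ᵛ ⟦ χ ⟧ᵛ
    instance-of (A3 φ ψ)    = schema-valid (A3 x₀ x₁)     ⟦ φ ⟧ᵛ ⟦ ψ ⟧ᵛ O
    instance-of (A4 φ ψ)    = schema-valid (A4 x₀ x₁)     ⟦ φ ⟧ᵛ ⟦ ψ ⟧ᵛ O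
    instance-of (A5 φ ψ χ)  = schema-valid (A5 x₀ x₁ x₂)  ⟦ φ ⟧ᵛ ⟦ ψ ⟧ᵛ ⟦ χ ⟧ᵛ
    instance-of (A6 φ ψ)    = schema-valid (A6 x₀ x₁)     ⟦ φ ⟧ᵛ ⟦ ψ ⟧ᵛ O
    instance-of (A7 φ ψ)    = schema-valid (A7 x₀ x₁)     ⟦ φ ⟧ᵛ ⟦ ψ ⟧ᵛ O
    instance-of (A8 φ ψ χ)  = schema-valid (A8 x₀ x₁ x₂)  ⟦ φ ⟧ᵛ ⟦ ψ ⟧ᵛ ⟦ χ ⟧ᵛ
    instance-of (A9 φ)      = schema-valid (A9 x₀)        ⟦ φ ⟧ᵛ O O
    instance-of (A10 φ)     = schema-valid (A10 x₀)       ⟦ φ ⟧ᵛ O O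
    instance-of (A11 φ ψ)   = schema-valid (A11 x₀ x₁)    ⟦ φ ⟧ᵛ ⟦ ψ ⟧ᵛ O
    instance-of (A12 φ ψ)   = schema-valid (A12 x₀ x₁)    ⟦ φ ⟧ᵛ ⟦ ψ ⟧ᵛ O
    instance-of (A13 φ ψ χ) = schema-valid (A13 x₀ x₁ x₂) ⟦ φ ⟧ᵛ ⟦ ψ ⟧ᵛ ⟦ χ ⟧ᵛ
    instance-of (A14 φ ψ)   = schema-valid (A14 x₀ x₁)    ⟦ φ ⟧ᵛ ⟦ ψ ⟧ᵛ O

  ¬∼-reflects-top : ∀ a c → BHA._≤_ five a ((I ⊸ c) ⇨ O) → a ≡ O ⊎ c ≡ I
  ¬∼-reflects-top = from-yes (all? λ a → all? λ c → (a ≟ a ⊓ ((I ⊸ c) ⇨ O)) →-dec (a ≟ O ⊎-dec c ≟ I))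

  open Soundness five axiom-valid public renaming (⊢w-sound to five-sound)

open Five using (five; O; A; B; I; valuation₃; ¬∼-reflects-top; five-sound)

⊢⊤ : ∀ {Γ} → Γ ⊢w ⊤'
⊢⊤ = mp (ax (A10 ⊤')) (ax (A10 (⊤' ⇒ ⊤')))

⊢⇒-refl : ∀ {Γ} φ → Γ ⊢w (φ ⇒ φ)
⊢⇒-refl φ = mp (ax (A1 φ φ)) (mp (ax (A1 φ (φ ⇒ φ))) (ax (A2 φ (φ ⇒ φ) φ)))

⊢∧-intro : ∀ {Γ φ ψ} → Γ ⊢w φ → Γ ⊢w ψ → Γ ⊢w (φ ∧' ψ)
⊢∧-intro {φ = φ} {ψ} ⊢φ ⊢ψ =
  mp ⊢φ (mp (mp ⊢ψ (ax (A1 ψ φ))) (mp (⊢⇒-refl φ) (ax (A8 φ ψ φ))))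

⊬⊥ : ¬ (∅ ⊢w ⊥')
⊬⊥ ⊢⊥ with five-sound ⊢⊥ I (λ _ → O) (λ ())
... | ()

_⟺_ : Formula → Formula → Formula
φ ⟺ ψ = (φ ⇒ ψ) ∧' (ψ ⇒ φ)

p q : Formula
p = var 0
q = var 1

module NoAlgebraicSemantics
  (τ : Pred (Equation ⊤) 0ℓ)
  (τ-semantics : (Γ : Pred Formula 0ℓ) (φ : Formula) → (Γ ⊢w φ) ⇔ (τ⟦ τ ⟧ Γ ⊨BHA τ⟨ τ ⟩ φ))
  where

  holds-at-top : ∀ 𝔸 → HoldsAt τ 𝔸 (BHA.top 𝔸)
  holds-at-top 𝔸 = holdsAt-τ⟨⟩ τ ⊤' (to (τ-semantics ∅ ⊤') ⊢⊤ 𝔸 (λ _ → BHA.top 𝔸) λ { (_ , () , _) })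

  ⊢¬∼⟺ : ∀ {ε δ} → (ε , δ) ∈ τ → ｛ p ｝ ⊢w ¬' (∼' ((ε [ p ]) ⟺ (δ [ p ])))
  ⊢¬∼⟺ {ε} {δ} ε≈δ = from (τ-semantics _ _) λ 𝔸 v sat →
    let open BHA-Properties 𝔸
        ε[p]≡δ[p] = sat (p , refl , ε , δ , ε≈δ , refl , refl)
    in satisfies-τ⟨⟩ τ _ (subst (HoldsAt τ 𝔸) (sym (¬∼-top (≡⇒⇔-top ε[p]≡δ[p]))) (holds-at-top 𝔸))

  holds-in-five : ∀ a → a ≢ O → HoldsAt τ five a
  holds-in-five a a≢O = holdsAt-τ⟨⟩ τ p λ { (ε , δ , ε≈δ , refl , refl) →
    [ (λ a≡O → ⊥-elim (a≢O a≡O)) , ⇔-top⇒≡ ]′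
      (¬∼-reflects-top a _ (five-sound (⊢¬∼⟺ ε≈δ) a (λ _ → a) λ { refl → ≤-refl a })) }
    where open BHA-Properties five

  holds-in-five-at-O : HoldsAt τ five O
  holds-in-five-at-O = holdsAt-τ⟨⟩ τ (p ∧' q) (to (τ-semantics Γ (p ∧' q)) ⊢p∧q five v sat)
    where
    Γ : Pred Formula 0ℓ
    Γ = ｛ p ｝ ∪ ｛ q ｝

    ⊢p∧q : Γ ⊢w (p ∧' q)
    ⊢p∧q = ⊢∧-intro (el (inj₁ refl)) (el (inj₂ refl))

    v : ℕ → Five.Five
    v = valuation₃ A B O

    sat : Satisfies five v (τ⟦ τ ⟧ Γ)
    sat = satisfies-τ⟦⟧ τ λ { (inj₁ refl) → holds-in-five A (λ ()) ; (inj₂ refl) → holds-in-five B (λ ()) }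

  holds-at-bot : ∀ 𝔸 → HoldsAt τ 𝔸 (BHA.bot 𝔸)
  holds-at-bot 𝔸 {ε} {δ} ε≈δ = begin
    ⟦ 𝔸 ⟧ ε (λ _ → bot)     ≡⟨ ⟦⟧-fromBool 𝔸 ε false̅ ⟩
    fromBool (truth ε false̅) ≡⟨ cong fromBool truth-ε≡truth-δ ⟩
    fromBool (truth δ false̅) ≡⟨ sym (⟦⟧-fromBool 𝔸 δ false̅) ⟩
    ⟦ 𝔸 ⟧ δ (λ _ → bot)     ∎
    where
    open ≡-Reasoning
    open BHA 𝔸 using (bot)
    open BHA-Properties 𝔸 using (fromBool)

    false̅ : ⊤ → Bool
    false̅ _ = false

    truth-ε≡truth-δ : truth ε false̅ ≡ truth δ false̅
    truth-ε≡truth-δ = BHA-Properties.fromBool-injective five (λ ())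
      (trans (sym (⟦⟧-fromBool five ε false̅)) (trans (holds-in-five-at-O ε≈δ) (⟦⟧-fromBool five δ false̅)))

  ⊢⊥ : ∅ ⊢w ⊥'
  ⊢⊥ = from (τ-semantics ∅ ⊥') λ 𝔸 v _ → satisfies-τ⟨⟩ τ ⊥' (holds-at-bot 𝔸)

mainTheorem7 : ¬ (Σ (Pred (Equation ⊤) 0ℓ) λ τ →
                    (Γ : Pred Formula 0ℓ) (φ : Formula) →
                      (Γ ⊢w φ) ⇔ (τ⟦ τ ⟧ Γ ⊨BHA τ⟨ τ ⟩ φ))
mainTheorem7 (τ , τ-semantics) = ⊬⊥ (NoAlgebraicSemantics.⊢⊥ τ τ-semantics)
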